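{- Fix a time domain $\mathbb{T}$ and a semantics $\psi$. Let $A$ be an algorithm relative to $\psi$ with finite set $T$ of critical terms, and for each state $X$ let $R^X$ be the rule defined below. If states $X$ and $Y$ of $A$ coincide over $T$ (i.e. $t^X=t^Y$ for all $t\in T$), then $\mathrm{gen}(R^X,Y)=\mathrm{gen}(Y)$.
   Context: Time: a set $\mathbb{T}$ with an associative binary operation $+$ having a neutral element $0$, and a total order $\le$ preserved by $+$. A timeline is a subset of $\mathbb{T}$ containing $0$; $\mathbb{I}$ is the set of timelines. A moment $i$ of a timeline $I$ is discrete if there is $t\in I$, $i<t$, with no $t'\in I$ strictly between; then $i^+$ is the smallest element of $I$ above $i$; otherwise $i$ is continuous. $I$ is non-Zeno if each $i\in I$ has only finitely many discrete $j\le i$ in $I$. Truncation: $I[i]=\{t\mid i+t\in I\}$. A dynamical system $\langle\mathcal{S},\mathcal{S}_0,\iota,\varphi\rangle$: a nonempty class $\mathcal{S}$ of states, nonempty subclass $\mathcal{S}_0$ of initial states, $\iota:\mathcal{S}\to\mathbb{I}$ with non-Zeno values, and $\varphi(X,i)\in\mathcal{S}$ for $X\in\mathcal{S}$, $i\in\iota(X)$, with $\varphi(X,0)=X$, $\iota(\varphi(X,i))=\iota(X)[i]$, $\varphi(X,i+i')=\varphi(\varphi(X,i),i')$ for $i,i+i'\in\iota(X)$. An abstract transition system is a dynamical system whose states are first-order structures over a finite vocabulary $\mathcal{V}$ such that: states and initial states are closed under isomorphism; $\varphi(X,i)$ has the same base set as $X$; if $\zeta: X\cong Y$ then $\iota(X)=\iota(Y)$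 and $\zeta:\varphi(X,i)\cong\varphi(Y,i)$ for all $i\in\iota(X)$. Locations $(f,\bar a)$, updates $(f,\bar a,b)$; for $X,Y$ on the same base set, $Y\setminus X$ is the set of updates $(f,\bar a,f^Y(\bar a))$ with $f^Y(\bar a)\ne f^X(\bar a)$. $X$ is a jump if $0$ is discrete in $\iota(X)$, a flow otherwise; for a jump, $\Delta^+(X)=\varphi(X,0^+)\setminus X$. A semantics $\psi$ over a class of sets is a partial function mapping functions from a timeline into a set $S$ of the class to elements of $S$. A function on a timeline is initially constant if constant on $[0,t]$ for some $t>0$. For a state $X$ and location $(f,\bar a)$, $\mathrm{Evolution}(X,(f,\bar a))$ is $t\mapsto f^{\varphi(X,t)}(\bar a)$ for $t\in\iota(X)$, $0\le t\le I_1$ for some $I_1\in\iota(X)$ ($I_1=0^+$ for a jump), and $\psi[X,f,\bar a]$ is its image under $\psi$. When defined for all locations, $\Delta_\psi(X)$ is the set of updates $(f,\bar a,\psi[X,f,\bar a])$ over locations whose evolution is not initially constant. The tagged generator is $\mathrm{gen}(X)=(\mathcal{F},\Delta_\psi(X))$ for a flow $X$ with $\Delta_\psi(X)$ defined and $(\mathcal{J},\Delta^+(X))$ for a jump $X$. An algorithm relative to $\psi$ is an abstract transition system with a finite set $T$ of ground terms (critical terms) such that any two states $X,Y$ with $t^X=t^Y$ for all $t\in T$ both have tagged generators, and these are equal. A critical element of $X$ is a value $t^X$, $t\in T$. Rules and $\mathrm{gen}(R,X)$: update rule $f(t_1,\dots,t_j):=t_0$ gives $(\mathcal{J},\{(f,(t_1^X,\dots,t_j^X),t_0^X)\})$;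 $\texttt{par } R_1\dots R_k\texttt{ endpar}$ (update rules) gives $(\mathcal{J},\bigcup_i d_i)$ where $\mathrm{gen}(R_i,X)=(\mathcal{J},d_i)$; $\textsc{Dynamic}(f(t_1,\dots,t_j),t_0)$ gives $(\mathcal{F},\{(f,(t_1^X,\dots,t_j^X),t_0^X)\})$; $\texttt{flow } R_1\dots R_k\texttt{ endflow}$ (basic continuous rules) gives $(\mathcal{F},\bigcup_i d_i)$. The rule $R^X$: every entry of every update in $\mathrm{gen}(X)$ is a critical element of $X$. If $X$ is a jump, $R^X$ is the parallel rule consisting of one update rule $f(t_1,\dots,t_j):=t_0$ for each update $(f,(a_1,\dots,a_j),a_0)\in\Delta^+(X)$, where $t_0,\dots,t_j\in T$ are chosen with $t_i^X=a_i$; if $X$ is a flow, $R^X$ is the flow rule consisting of one rule $\textsc{Dynamic}(f(t_1,\dots,t_j),t_0)$ for each update $(f,(a_1,\dots,a_j),a_0)\in\Delta_\psi(X)$, with $t_0,\dots,t_j\in T$ chosen with $t_i^X=a_i$. Thus $\mathrm{gen}(R^X,X)=\mathrm{gen}(X)$ and $R^X$ involves only critical terms. -}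

module Defs where

open import Data.Nat using (ℕ)
open import Data.Fin using (Fin)
open import Data.Vec using (Vec; []; _∷_)
import Data.Vec as Vec
open import Data.Vec.Relation.Unary.All using () renaming (All to AllV)
open import Data.List using (List)
import Data.List as List
open import Data.List.Membership.Propositional using (_∈_)
open import Data.List.Relation.Unary.All using () renaming (All to AllL)
open import Data.List.Relation.Unary.Unique.Propositional using (Unique)
open import Data.Product using (Σ; _×_; _,_)
open import Data.Sum using (_⊎_)
open import Data.Maybe using (Maybe; just)
open import Relation.Nullary using (¬_)
open import Relation.Binary.PropositionalEquality using (_≡_; _≢_)
open import Algebra.Structures using (IsMonoid)
open import Relation.Binary.Structures using (IsTotalOrder)

record TimeDomain : Set₁ where
  field
    𝕋 : Set
    _+_ : 𝕋 → 𝕋 → 𝕋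
    0ₜ : 𝕋
    +-isMonoid : IsMonoid _≡_ _+_ 0ₜ
    _≤_ : 𝕋 → 𝕋 → Set
    ≤-isTotalOrder : IsTotalOrder _≡_ _≤_
    +-mono-≤ : ∀ {a b} c → a ≤ b → ((a + c) ≤ (b + c)) × ((c + a) ≤ (c + b))

record Vocabulary : Set where
  field
    nsym : ℕ
    arity : Fin nsym → ℕ

-- Everything else, relative to a time domain TD, a vocabulary V and an
-- ambient type U of elements (base sets of structures are subsets of U).

module Core (TD : TimeDomain) (V : Vocabulary) (U : Set) where

  open TimeDomain TD public
  open Vocabulary V public

  _⇔_ : Set → Set → Set
  A ⇔ B = (A → B) × (B → A)

  _<_ : 𝕋 → 𝕋 → Set
  a < b = (a ≤ b) × (a ≢ b)

  -- a subset of 𝕋; a timeline is such a subset containing 0ₜ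
  Timeline : Set₁
  Timeline = 𝕋 → Set

  _≐_ : Timeline → Timeline → Set
  I ≐ J = ∀ t → I t ⇔ J t

  IsSucc : Timeline → 𝕋 → 𝕋 → Set
  IsSucc I i t = I t × (i < t) × (∀ t' → I t' → ¬ ((i < t') × (t' < t)))

  Discrete : Timeline → 𝕋 → Set
  Discrete I i = I i × Σ 𝕋 (IsSucc I i)

  FiniteSubset : (𝕋 → Set) → Set
  FiniteSubset P = Σ (List 𝕋) λ l → ∀ j → P j → j ∈ l

  NonZeno : Timeline → Set
  NonZeno I = ∀ i → I i → FiniteSubset (λ j → Discrete I j × (j ≤ i))

  _[_] : Timeline → 𝕋 → Timeline
  (I [ i ]) t = I (i + t)

  Sym : Set
  Sym = Fin nsym

  Interp : Set
  Interp = (f : Sym) → Vec U (arity f) → U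

  record Structure : Set₁ where
    constructor mkStr
    field
      Base : U → Set
      int : Interp
      closed : ∀ f (as : Vec U (arity f)) → AllV Base as → Base (int f as)
  open Structure public

  _≈ˢ_ : Structure → Structure → Set
  X ≈ˢ Y = (∀ u → Base X u ⇔ Base Y u)
         × (∀ f as → AllV (Base X) as → int X f as ≡ int Y f as)

  record IsIso (to from : U → U) (X Y : Structure) : Set where
    field
      to-base : ∀ {u} → Base X u → Base Y (to u)
      from-base : ∀ {u} → Base Y u → Base X (from u)
      from-to : ∀ {u} → Base X u → from (to u) ≡ u
      to-from : ∀ {u} → Base Y u → to (from u) ≡ u
      hom : ∀ f as → AllV (Base X) as → to (int X f as) ≡ int Y f (Vec.map to as)

  _≅_ : Structure → Structure → Set
  X ≅ Y = Σ (U → U) λ to → Σ (U → U) λ from → IsIso to from X Y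

  data Term : Set where
    app : (f : Sym) → Vec Term (arity f) → Term

  mutual
    eval : Structure → Term → U
    eval X (app f ts) = int X f (evals X ts)

    evals : Structure → ∀ {k} → Vec Term k → Vec U k
    evals X [] = []
    evals X (t ∷ ts) = eval X t ∷ evals X ts

  Update : Set
  Update = Σ Sym λ f → Vec U (arity f) × U

  UpdateSet : Set₁
  UpdateSet = Update → Set

  _≐ᵘ_ : UpdateSet → UpdateSet → Set
  D ≐ᵘ E = ∀ u → D u ⇔ E u

  -- Y ∖ X (for X, Y on the same base set)
  _∖ˢ_ : Structure → Structure → UpdateSet
  (Y ∖ˢ X) (f , as , b) = AllV (Base X) as × (b ≡ int Y f as) × (int Y f as ≢ int X f as)

  Semantics : Set₁
  Semantics = (I : Timeline) → (Σ 𝕋 I → U) → Maybe U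

  InitiallyConstant : (I : Timeline) → (Σ 𝕋 I → U) → Set
  InitiallyConstant I g =
    Σ 𝕋 λ t → (0ₜ < t) ×
      (∀ s s' (p : I s) (p' : I s') → 0ₜ ≤ s → s ≤ t → 0ₜ ≤ s' → s' ≤ t →
         g (s , p) ≡ g (s' , p'))

  data Tag : Set where
    𝓕 𝓙 : Tag

  Generator : Set₁
  Generator = Tag × UpdateSet

  _≈ᵍ_ : Generator → Generator → Set
  (τ , D) ≈ᵍ (τ' , E) = (τ ≡ τ') × (D ≐ᵘ E)

  record ATS : Set₁ where
    field
      IsState : Structure → Set
      IsInit : Structure → Set
      init⇒state : ∀ X → IsInit X → IsState X
      init-nonempty : Σ Structure IsInit
      ι : Structure → Timeline
      ι-timeline : ∀ X → IsState X → ι X 0ₜ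
      ι-nonZeno : ∀ X → IsState X → NonZeno (ι X)
      φ : Structure → 𝕋 → Structure
      φ-state : ∀ X i → IsState X → ι X i → IsState (φ X i)
      φ-0 : ∀ X → IsState X → φ X 0ₜ ≈ˢ X
      φ-ι : ∀ X i → IsState X → ι X i → ι (φ X i) ≐ (ι X [ i ])
      φ-+ : ∀ X i i' → IsState X → ι X i → ι X (i + i') →
              φ X (i + i') ≈ˢ φ (φ X i) i'
      φ-base : ∀ X i → IsState X → ι X i → ∀ u → Base (φ X i) u ⇔ Base X u
      state-iso : ∀ X Y → IsState X → X ≅ Y → IsState Y
      init-iso : ∀ X Y → IsInit X → X ≅ Y → IsInit Y
      iso-ι : ∀ X Y → IsState X → X ≅ Y → ι X ≐ ι Y
      iso-φ : ∀ X Y to from → IsState X → IsIso to from X Y →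
                ∀ i → ι X i → IsIso to from (φ X i) (φ Y i)

    IsJump : Structure → Set
    IsJump X = Discrete (ι X) 0ₜ

    Δ⁺ : Structure → UpdateSet
    Δ⁺ X u = Σ 𝕋 λ t → IsSucc (ι X) 0ₜ t × (φ X t ∖ˢ X) u

  module WithSemantics (ψ : Semantics) (I₁ : Structure → 𝕋) (A : ATS) where
    open ATS A

    EvDom : Structure → Timeline
    EvDom X t = ι X t × (0ₜ ≤ t) × (t ≤ I₁ X)

    Evolution : (X : Structure) (f : Sym) → Vec U (arity f) → Σ 𝕋 (EvDom X) → U
    Evolution X f as (t , _) = int (φ X t) f as

    ψ[_,_,_] : (X : Structure) (f : Sym) → Vec U (arity f) → Maybe U
    ψ[ X , f , as ] = ψ (EvDom X) (Evolution X f as)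

    Δψ-defined : Structure → Set
    Δψ-defined X = ∀ f as → AllV (Base X) as → Σ U λ b → ψ[ X , f , as ] ≡ just b

    Δψ : Structure → UpdateSet
    Δψ X (f , as , b) =
      AllV (Base X) as × ¬ InitiallyConstant (EvDom X) (Evolution X f as)
        × (ψ[ X , f , as ] ≡ just b)

    -- gen(X) = g  (gen is a partial function; this is its graph)
    HasGen : Structure → Generator → Set
    HasGen X (𝓙 , D) = IsJump X × (D ≐ᵘ Δ⁺ X)
    HasGen X (𝓕 , D) = ¬ IsJump X × Δψ-defined X × (D ≐ᵘ Δψ X)

  record Algorithm (ψ : Semantics) (I₁ : Structure → 𝕋) : Set₁ where
    field
      ats : ATS
    open ATS ats public
    open WithSemantics ψ I₁ ats public
    field
      critical : List Term

    Coincide : Structure → Structure → Set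
    Coincide X Y = ∀ t → t ∈ critical → eval X t ≡ eval Y t

    field
      algorithm : ∀ X Y → IsState X → IsState Y → Coincide X Y →
        Σ Generator λ gX → Σ Generator λ gY →
          HasGen X gX × HasGen Y gY × (gX ≈ᵍ gY)

  -- f(t₁,…,tⱼ) together with t₀ : the data of an update rule
  -- f(t₁,…,tⱼ) := t₀  or of a rule Dynamic(f(t₁,…,tⱼ), t₀)
  RuleAtom : Set
  RuleAtom = Σ Sym λ f → Vec Term (arity f) × Term

  data Rule : Set where
    update : RuleAtom → Rule
    par : List RuleAtom → Rule
    dynamic : RuleAtom → Rule
    flow : List RuleAtom → Rule

  evalAtom : Structure → RuleAtom → Update
  evalAtom X (f , ts , t₀) = (f , evals X ts , eval X t₀)

  genR : Rule → Structure → Generator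
  genR (update r) X = 𝓙 , λ u → u ≡ evalAtom X r
  genR (par rs) X = 𝓙 , λ u → u ∈ List.map (evalAtom X) rs
  genR (dynamic r) X = 𝓕 , λ u → u ≡ evalAtom X r
  genR (flow rs) X = 𝓕 , λ u → u ∈ List.map (evalAtom X) rs

  AtomTerms : RuleAtom → List Term
  AtomTerms (f , ts , t₀) = t₀ List.∷ Vec.toList ts

  module RX {ψ : Semantics} {I₁ : Structure → 𝕋} (A : Algorithm ψ I₁) where
    open Algorithm A

    OneAtomPerUpdate : Structure → UpdateSet → List RuleAtom → Set
    OneAtomPerUpdate X D rs =
      AllL (λ r → AllL (_∈ critical) (AtomTerms r)) rs
      × Unique (List.map (evalAtom X) rs)
      × (∀ u → (u ∈ List.map (evalAtom X) rs) ⇔ D u)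

    IsRX : Structure → Rule → Set
    IsRX X R =
      (IsJump X × Σ (List RuleAtom) λ rs → (R ≡ par rs) × OneAtomPerUpdate X (Δ⁺ X) rs)
      ⊎ (¬ IsJump X × Σ (List RuleAtom) λ rs → (R ≡ flow rs) × OneAtomPerUpdate X (Δψ X) rs)

-- R^X is built only from critical terms, so on any Y coinciding with X over
-- the critical terms it produces exactly the same updates as on X, namely
-- gen(X); and gen(X) = gen(Y) because A is an algorithm.
module Submission where

open import Defs
open import Data.Product using (Σ; _×_; _,_)
open import Data.Sum using (inj₁; inj₂)
open import Data.Vec using (Vec; []; _∷_)
import Data.Vec as Vec
open import Data.List using (List; map)
import Data.List as List
open import Data.List.Relation.Unary.All using (All; _∷_; [])
open import Data.List.Membership.Propositional using (_∈_)
open import Data.Empty using (⊥-elim)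
open import Function using (_∘_)
open import Relation.Binary.PropositionalEquality using (_≡_; refl; cong; cong₂; subst)

module Generators (TD : TimeDomain) (V : Vocabulary) (U : Set) where
  open Core TD V U

  ⇔-trans : ∀ {A B C} → A ⇔ B → B ⇔ C → A ⇔ C
  ⇔-trans (f , f⁻) (g , g⁻) = g ∘ f , f⁻ ∘ g⁻

  ⇔-sym : ∀ {A B} → A ⇔ B → B ⇔ A
  ⇔-sym (f , f⁻) = f⁻ , f

  ≐ᵘ-trans : ∀ {D E F} → D ≐ᵘ E → E ≐ᵘ F → D ≐ᵘ F
  ≐ᵘ-trans D≐E E≐F u = ⇔-trans (D≐E u) (E≐F u)

  ≈ᵍ-trans : ∀ {g h k} → g ≈ᵍ h → h ≈ᵍ k → g ≈ᵍ k
  ≈ᵍ-trans (refl , D≐E) (refl , E≐F) = refl , ≐ᵘ-trans D≐E E≐F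

  module _ {ψ : Semantics} {I₁ : Structure → 𝕋} (A : Algorithm ψ I₁) where
    open Algorithm A
    open RX A

    evals-coincide : ∀ {X Y} → Coincide X Y → ∀ {k} (ts : Vec Term k) →
                     All (_∈ critical) (Vec.toList ts) → evals X ts ≡ evals Y ts
    evals-coincide X≡Y [] [] = refl
    evals-coincide X≡Y (t ∷ ts) (t∈ ∷ ts∈) =
      cong₂ _∷_ (X≡Y t t∈) (evals-coincide X≡Y ts ts∈)

    evalAtom-coincide : ∀ {X Y} → Coincide X Y → ∀ r →
                        All (_∈ critical) (AtomTerms r) → evalAtom X r ≡ evalAtom Y r
    evalAtom-coincide X≡Y (f , ts , t₀) (t₀∈ ∷ ts∈) =
      cong₂ (λ as b → f , as , b) (evals-coincide X≡Y ts ts∈) (X≡Y t₀ t₀∈)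

    map-evalAtom-coincide : ∀ {X Y} → Coincide X Y → ∀ rs →
                            All (λ r → All (_∈ critical) (AtomTerms r)) rs →
                            map (evalAtom X) rs ≡ map (evalAtom Y) rs
    map-evalAtom-coincide X≡Y List.[] [] = refl
    map-evalAtom-coincide X≡Y (r List.∷ rs) (r∈ ∷ rs∈) =
      cong₂ List._∷_ (evalAtom-coincide X≡Y r r∈) (map-evalAtom-coincide X≡Y rs rs∈)

    genR-coincide : ∀ {X Y R} → Coincide X Y → IsRX X R → genR R X ≡ genR R Y
    genR-coincide X≡Y (inj₁ (_ , rs , refl , rs∈ , _)) =
      cong (λ l → 𝓙 , λ u → u ∈ l) (map-evalAtom-coincide X≡Y rs rs∈)
    genR-coincide X≡Y (inj₂ (_ , rs , refl , rs∈ , _)) =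
      cong (λ l → 𝓕 , λ u → u ∈ l) (map-evalAtom-coincide X≡Y rs rs∈)

    genR-RX : ∀ {X R} → IsRX X R → ∀ {g} → HasGen X g → genR R X ≈ᵍ g
    genR-RX (inj₁ (_ , _ , refl , _ , _ , rs≐Δ⁺)) {𝓙 , D} (_ , D≐Δ⁺) =
      refl , λ u → ⇔-trans (rs≐Δ⁺ u) (⇔-sym (D≐Δ⁺ u))
    genR-RX (inj₁ (jump , _)) {𝓕 , _} (¬jump , _) = ⊥-elim (¬jump jump)
    genR-RX (inj₂ (¬jump , _)) {𝓙 , _} (jump , _) = ⊥-elim (¬jump jump)
    genR-RX (inj₂ (_ , _ , refl , _ , _ , rs≐Δψ)) {𝓕 , D} (_ , _ , D≐Δψ) =
      refl , λ u → ⇔-trans (rs≐Δψ u) (⇔-sym (D≐Δψ u))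

lemma3 : (TD : TimeDomain) (V : Vocabulary) (U : Set) →
    let open Core TD V U in
    (ψ : Semantics) (I₁ : Structure → 𝕋) (A : Algorithm ψ I₁) →
    let open Algorithm A in
    let open RX A in
    (∀ X → IsState X → ι X (I₁ X)) →
    ∀ X Y → IsState X → IsState Y → Coincide X Y →
    ∀ R → IsRX X R →
    Σ Generator λ g → HasGen Y g × (genR R Y ≈ᵍ g)
lemma3 TD V U ψ I₁ A _ X Y sX sY X≡Y R R-is-RX =
  let gX , gY , genX , genY , gX≈gY = algorithm X Y sX sY X≡Y in
  gY , genY ,
  subst (_≈ᵍ gY) (genR-coincide A X≡Y R-is-RX) (≈ᵍ-trans (genR-RX A R-is-RX genX) gX≈gY)
  where
    open Core TD V U
    open Algorithm A
    open Generators TD V U
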